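{- Let $Y$ be a generalised binary matrix and let $Y'$ be obtained from $Y$ by removing a simplicial $1$ of $Y$. Then $i(Y)=i(Y')+1$ and $br(Y)=br(Y')+1$.
   Context: A generalised binary matrix is a matrix $Y=(y_{i,j})$ with entries in $\{0,1,?\}$; $\operatorname{supp}(Y)=\{(i,j):y_{i,j}=1\}$. A rectangle of $Y$ is a submatrix $I\times J$ ($I$ a set of rows, $J$ a set of columns) containing no entry $0$. $br(Y)$ is the minimum number of rectangles whose union contains $\operatorname{supp}(Y)$. An isolated set is a subset of $\operatorname{supp}(Y)$ no two elements of which lie in a common rectangle; $i(Y)$ is the maximum size of an isolated set. An entry $(\ell,k)\in\operatorname{supp}(Y)$ is a simplicial $1$ if, with $I=\{i:y_{i,k}\in\{1,?\}\}$ and $J=\{j:y_{\ell,j}\in\{1,?\}\}$, the set $I\times J$ is a rectangle of $Y$. Removing the simplicial $1$ at $(\ell,k)$ means deleting row $\ell$ and column $k$ and setting all remaining entries with positions in $I\times J$ to $?$. -}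

module Defs where

open import Data.Nat using (ℕ; suc; _≤_)
open import Data.Fin using (Fin; punchIn)
open import Data.Bool using (Bool; true; false; _∧_; if_then_else_)
open import Data.Product using (Σ; ∃; _×_; _,_)
open import Data.List using (List; length)
open import Data.List.Membership.Propositional using (_∈_)
open import Data.List.Relation.Unary.Unique.Propositional using (Unique)
open import Relation.Binary.PropositionalEquality using (_≡_; _≢_)
open import Relation.Nullary using (¬_)

data Entry : Set where
  𝟘 𝟙 ⁇ : Entry

Mat : ℕ → ℕ → Set
Mat m n = Fin m → Fin n → Entry

Pos : ℕ → ℕ → Set
Pos m n = Fin m × Fin n

InSupp : ∀ {m n} → Mat m n → Pos m n → Set
InSupp Y (i , j) = Y i j ≡ 𝟙

record Sub (m n : ℕ) : Set where
  constructor _⊗_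
  field
    rows : Fin m → Bool
    cols : Fin n → Bool
open Sub public

_∈S_ : ∀ {m n} → Pos m n → Sub m n → Set
(i , j) ∈S R = (rows R i ≡ true) × (cols R j ≡ true)

IsRect : ∀ {m n} → Mat m n → Sub m n → Set
IsRect Y R = ∀ i j → (i , j) ∈S R → Y i j ≢ 𝟘

Cover : ∀ {m n} → Mat m n → ℕ → Set
Cover {m} {n} Y k =
  Σ (Fin k → Sub m n) λ R →
    (∀ t → IsRect Y (R t)) ×
    (∀ p → InSupp Y p → ∃ λ t → p ∈S R t)

IsBr : ∀ {m n} → Mat m n → ℕ → Set
IsBr Y b = Cover Y b × (∀ k → Cover Y k → b ≤ k)

Isolated : ∀ {m n} → Mat m n → List (Pos m n) → Set
Isolated Y S =
  Unique S ×
  (∀ p → p ∈ S → InSupp Y p) ×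
  (∀ p q → p ∈ S → q ∈ S → p ≢ q →
     ¬ (Σ _ λ R → IsRect Y R × p ∈S R × q ∈S R))

IsI : ∀ {m n} → Mat m n → ℕ → Set
IsI Y a =
  (∃ λ S → Isolated Y S × length S ≡ a) ×
  (∀ S → Isolated Y S → length S ≤ a)

nonzero : Entry → Bool
nonzero 𝟘 = false
nonzero 𝟙 = true
nonzero ⁇ = true

Simplicial : ∀ {m n} → Mat m n → Fin m → Fin n → Set
Simplicial Y ℓ k =
  Y ℓ k ≡ 𝟙 × IsRect Y ((λ i → nonzero (Y i k)) ⊗ (λ j → nonzero (Y ℓ j)))

-- remove row ℓ and column k; remaining entries in I × J become ?
removeAt : ∀ {m n} → Mat (suc m) (suc n) → Fin (suc m) → Fin (suc n) → Mat m n
removeAt Y ℓ k i j =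
  if nonzero (Y (punchIn ℓ i) k) ∧ nonzero (Y ℓ (punchIn k j))
  then ⁇
  else Y (punchIn ℓ i) (punchIn k j)

-- The rectangle I × J of the simplicial 1 at (ℓ , k) contains every rectangle through (ℓ , k),
-- and removal turns it into ?s, so no 1 of Y′ shares a rectangle with (ℓ , k). Rectangles of Y
-- restrict to rectangles of Y′; since I × J has no 0, rectangles of Y′ extend to rectangles
-- of Y avoiding row ℓ and column k; and the 1s of Y outside I × J are exactly the 1s of Y′.
-- So a cover (isolated set) of Y′ plus I × J (plus (ℓ , k)) is one of Y, and conversely a cover
-- of Y minus the rectangle through (ℓ , k), or an isolated set of Y minus its at most one entry
-- in I × J, yields one of Y′.
module Submission where

open import Defs
open import Data.Nat using (zero; suc; _≤_; z≤n; s≤s; s≤s⁻¹)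
open import Data.Nat.Properties using (≤-trans; ≤-reflexive; m≤n⇒m⊓n≡m)
open import Data.Fin using (Fin; zero; suc; punchIn; punchOut; _≟_)
open import Data.Fin.Properties using (punchIn-injective; punchInᵢ≢i; punchIn-punchOut)
open import Data.Bool using (Bool; true; false; _∧_)
open import Data.Bool.Properties using (¬-not) renaming (_≟_ to _≟ᵇ_)
open import Data.Vec.Functional using (insertAt)
open import Data.Vec.Functional.Properties using (insertAt-lookup; insertAt-punchIn)
open import Data.Product using (Σ; ∃; _×_; _,_; proj₁; proj₂)
open import Data.List using (List; []; _∷_; length; map; filter; take)
open import Data.List.Properties using (filter-all; length-map; length-take)
open import Data.List.Membership.Propositional using (_∈_)
open import Data.List.Membership.Propositional.Properties using (∈-map⁻; ∈-map⁺; ∈-filter⁻)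
open import Data.List.Relation.Unary.Any using (here; there)
open import Data.List.Relation.Unary.All as All using (All; []; _∷_)
open import Data.List.Relation.Unary.AllPairs using (_∷_)
open import Data.List.Relation.Unary.Unique.Propositional using (Unique)
open import Data.List.Relation.Unary.Unique.Propositional.Properties using (map⁺; map⁻; filter⁺; take⁺)
open import Data.List.Relation.Binary.Sublist.Propositional using (lookup)
open import Data.List.Relation.Binary.Sublist.Propositional.Properties using (take-⊆)
open import Relation.Nullary using (¬_; yes; no; contradiction)
open import Relation.Nullary.Decidable using (decidable-stable)
open import Relation.Unary using (Decidable)
open import Relation.Binary.PropositionalEquality
  using (_≡_; _≢_; refl; sym; trans; cong; cong₂; subst)
open import Function.Bundles using (_⇔_; mk⇔)

true≢false : true ≢ false
true≢false ()

∧-true⁻ : ∀ {a b} → a ∧ b ≡ true → a ≡ true × b ≡ true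
∧-true⁻ {true} {true} refl = refl , refl

∧-true⁺ : ∀ {a b} → a ≡ true → b ≡ true → a ∧ b ≡ true
∧-true⁺ refl refl = refl

nonzero-≢𝟘 : ∀ {e} → e ≢ 𝟘 → nonzero e ≡ true
nonzero-≢𝟘 {𝟘} e≢𝟘 = contradiction refl e≢𝟘
nonzero-≢𝟘 {𝟙} _   = refl
nonzero-≢𝟘 {⁇} _   = refl

insertAt-false≡true⁻ : ∀ {n} (f : Fin n → Bool) (ℓ : Fin (suc n)) i′ →
                       insertAt f ℓ false i′ ≡ true → ∃ λ i → punchIn ℓ i ≡ i′ × f i ≡ true
insertAt-false≡true⁻ f ℓ i′ fi′ with ℓ ≟ i′
... | yes refl = contradiction (trans (sym (insertAt-lookup f ℓ false)) fi′) λ ()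
... | no ℓ≢i′ = punchOut ℓ≢i′ , punchIn-punchOut ℓ≢i′ ,
  trans (sym (insertAt-punchIn f ℓ false _))
        (subst (λ x → insertAt f ℓ false x ≡ true) (sym (punchIn-punchOut ℓ≢i′)) fi′)

module _ {A B : Set} (f : B → A) where

  preimage : (xs : List A) → All (λ x → ∃ λ y → f y ≡ x) xs → List B
  preimage []       []             = []
  preimage (_ ∷ xs) ((y , _) ∷ ps) = y ∷ preimage xs ps

  map-preimage : ∀ xs ps → map f (preimage xs ps) ≡ xs
  map-preimage []       []                = refl
  map-preimage (_ ∷ xs) ((_ , refl) ∷ ps) = cong (_ ∷_) (map-preimage xs ps)

  length-preimage : ∀ xs ps → length (preimage xs ps) ≡ length xs
  length-preimage xs ps = trans (sym (length-map f (preimage xs ps))) (cong length (map-preimage xs ps))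

  ∈-preimage⁻ : ∀ {xs ps y} → y ∈ preimage xs ps → f y ∈ xs
  ∈-preimage⁻ {xs} {ps} y∈ = subst (f _ ∈_) (map-preimage xs ps) (∈-map⁺ f y∈)

  preimage⁺ : ∀ {xs} ps → Unique xs → Unique (preimage xs ps)
  preimage⁺ {xs} ps u = map⁻ (subst Unique (sym (map-preimage xs ps)) u)

module _ {A : Set} {P : A → Set} (P? : Decidable P) where

  length≤1+length-filter : ∀ {xs} → Unique xs →
    (∀ {x y} → x ∈ xs → y ∈ xs → ¬ P x → ¬ P y → ¬ x ≢ y) →
    length xs ≤ suc (length (filter P? xs))
  length≤1+length-filter {[]}     _              _        = z≤n
  length≤1+length-filter {x ∷ xs} (x∉xs ∷ uxs) ¬P-unique with P? x
  ... | yes _  = s≤s (length≤1+length-filter uxs λ x∈ y∈ → ¬P-unique (there x∈) (there y∈))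
  ... | no ¬Px = s≤s (≤-reflexive (cong length (sym (filter-all P? all-P))))
    where
    all-P : All P xs
    all-P = All.tabulate λ y∈ → decidable-stable (P? _) λ ¬Py →
      ¬P-unique (here refl) (there y∈) ¬Px ¬Py (All.lookup x∉xs y∈)

Isolated-take : ∀ {m n} {Y : Mat m n} a {S} → Isolated Y S → Isolated Y (take a S)
Isolated-take a {S} (uS , suppS , isoS) =
  take⁺ a uS , (λ p p∈ → suppS p (⊆S p∈)) , (λ p q p∈ q∈ → isoS p q (⊆S p∈) (⊆S q∈))
  where
  ⊆S : ∀ {p} → p ∈ take a S → p ∈ S
  ⊆S = lookup (take-⊆ a S)

module Removal {m n} (Y : Mat (suc m) (suc n)) (ℓ : Fin (suc m)) (k : Fin (suc n)) where

  Y′ : Mat m n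
  Y′ = removeAt Y ℓ k

  block : Sub (suc m) (suc n)
  block = (λ i → nonzero (Y i k)) ⊗ (λ j → nonzero (Y ℓ j))

  inBlock : Pos (suc m) (suc n) → Bool
  inBlock (i , j) = rows block i ∧ cols block j

  embed : Pos m n → Pos (suc m) (suc n)
  embed (i , j) = punchIn ℓ i , punchIn k j

  embed-injective : ∀ {p q} → embed p ≡ embed q → p ≡ q
  embed-injective {i , j} {i₂ , j₂} eq =
    cong₂ _,_ (punchIn-injective ℓ i i₂ (cong proj₁ eq)) (punchIn-injective k j j₂ (cong proj₂ eq))

  removeAt-𝟘⁻ : ∀ i j → Y′ i j ≡ 𝟘 → Y (punchIn ℓ i) (punchIn k j) ≡ 𝟘
  removeAt-𝟘⁻ i j with inBlock (embed (i , j))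
  ... | true  = λ ()
  ... | false = λ e → e

  removeAt-𝟘⁺ : IsRect Y block → ∀ i j → Y (punchIn ℓ i) (punchIn k j) ≡ 𝟘 → Y′ i j ≡ 𝟘
  removeAt-𝟘⁺ block-rect i j e with inBlock (embed (i , j)) in inB
  ... | true  = contradiction e (block-rect _ _ (∧-true⁻ inB))
  ... | false = e

  removeAt-𝟙⁻ : ∀ i j → Y′ i j ≡ 𝟙 → inBlock (embed (i , j)) ≡ false × Y (punchIn ℓ i) (punchIn k j) ≡ 𝟙
  removeAt-𝟙⁻ i j with inBlock (embed (i , j))
  ... | true  = λ ()
  ... | false = λ e → refl , e

  removeAt-𝟙⁺ : ∀ i j → inBlock (embed (i , j)) ≡ false → Y (punchIn ℓ i) (punchIn k j) ≡ 𝟙 → Y′ i j ≡ 𝟙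
  removeAt-𝟙⁺ i j outside y≡𝟙 rewrite outside = y≡𝟙

  restrict : Sub (suc m) (suc n) → Sub m n
  restrict R = (λ i → rows R (punchIn ℓ i)) ⊗ (λ j → cols R (punchIn k j))

  IsRect-restrict : ∀ {R} → IsRect Y R → IsRect Y′ (restrict R)
  IsRect-restrict R-rect i j ij∈R e = R-rect _ _ ij∈R (removeAt-𝟘⁻ i j e)

  extend : Sub m n → Sub (suc m) (suc n)
  extend R = insertAt (rows R) ℓ false ⊗ insertAt (cols R) k false

  ∈-extend : ∀ {R} p → p ∈S R → embed p ∈S extend R
  ∈-extend {R} (i , j) (i∈ , j∈) =
    trans (insertAt-punchIn (rows R) ℓ false i) i∈ , trans (insertAt-punchIn (cols R) k false j) j∈

  IsRect-extend : IsRect Y block → ∀ {R} → IsRect Y′ R → IsRect Y (extend R)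
  IsRect-extend block-rect {R} R-rect i′ j′ (i′∈ , j′∈) e
    with insertAt-false≡true⁻ (rows R) ℓ i′ i′∈ | insertAt-false≡true⁻ (cols R) k j′ j′∈
  ... | i , refl , i∈ | j , refl , j∈ = R-rect i j (i∈ , j∈) (removeAt-𝟘⁺ block-rect i j e)

  -- A rectangle through (ℓ , k) lies inside I × J, where Y′ has no 1.
  rect∋ℓk⇒¬supp : ∀ {R} → IsRect Y R → (ℓ , k) ∈S R → ∀ p → embed p ∈S R → ¬ InSupp Y′ p
  rect∋ℓk⇒¬supp R-rect (ℓ∈ , k∈) (i , j) (i∈ , j∈) y′ =
    contradiction (∧-true⁺ (nonzero-≢𝟘 (R-rect _ k (i∈ , k∈))) (nonzero-≢𝟘 (R-rect ℓ _ (ℓ∈ , j∈))))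
                  λ inB → true≢false (trans (sym inB) (proj₁ (removeAt-𝟙⁻ i j y′)))

  module _ (simplicial : Simplicial Y ℓ k) where

    private
      ℓk∈supp : InSupp Y (ℓ , k)
      ℓk∈supp = proj₁ simplicial

      block-rect : IsRect Y block
      block-rect = proj₂ simplicial

    supp∖block⊆embed : ∀ p′ → InSupp Y p′ → inBlock p′ ≡ false → ∃ λ p → embed p ≡ p′ × InSupp Y′ p
    supp∖block⊆embed (i′ , j′) y1 outside = p , embed-p , y′1
      where
      ℓ≢i′ : ℓ ≢ i′
      ℓ≢i′ refl = true≢false (trans (sym (∧-true⁺ (cong nonzero ℓk∈supp) (cong nonzero y1))) outside)
      k≢j′ : k ≢ j′
      k≢j′ refl = true≢false (trans (sym (∧-true⁺ (cong nonzero y1) (cong nonzero ℓk∈supp))) outside)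
      p : Pos m n
      p = punchOut ℓ≢i′ , punchOut k≢j′
      embed-p : embed p ≡ (i′ , j′)
      embed-p = cong₂ _,_ (punchIn-punchOut ℓ≢i′) (punchIn-punchOut k≢j′)
      y′1 : InSupp Y′ p
      y′1 = removeAt-𝟙⁺ _ _ (subst (λ q → inBlock q ≡ false) (sym embed-p) outside)
                            (subst (InSupp Y) (sym embed-p) y1)

    Cover-remove : ∀ {b} → Cover Y (suc b) → Cover Y′ b
    Cover-remove {b} (R , R-rect , R-cov) with R-cov (ℓ , k) ℓk∈supp
    ... | t₀ , ℓk∈R = R′ , (λ t → IsRect-restrict (R-rect _)) , R′-cov
      where
      R′ : Fin b → Sub m n
      R′ t = restrict (R (punchIn t₀ t))
      R′-cov : ∀ p → InSupp Y′ p → ∃ λ t → p ∈S R′ t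
      R′-cov p y′1 with R-cov (embed p) (proj₂ (removeAt-𝟙⁻ _ _ y′1))
      ... | t , p∈R = punchOut t₀≢t , subst (λ s → embed p ∈S R s) (sym (punchIn-punchOut t₀≢t)) p∈R
        where
        t₀≢t : t₀ ≢ t
        t₀≢t refl = rect∋ℓk⇒¬supp (R-rect t₀) ℓk∈R p p∈R y′1

    Cover-add : ∀ {b} → Cover Y′ b → Cover Y (suc b)
    Cover-add {b} (R′ , R′-rect , R′-cov) = R , R-rect , R-cov
      where
      R : Fin (suc b) → Sub (suc m) (suc n)
      R zero    = block
      R (suc t) = extend (R′ t)
      R-rect : ∀ t → IsRect Y (R t)
      R-rect zero    = block-rect
      R-rect (suc t) = IsRect-extend block-rect (R′-rect t)
      R-cov : ∀ p′ → InSupp Y p′ → ∃ λ t → p′ ∈S R t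
      R-cov p′ y1 with inBlock p′ in inB
      ... | true  = zero , ∧-true⁻ inB
      ... | false with supp∖block⊆embed p′ y1 inB
      ... | p , refl , y′1 with R′-cov p y′1
      ... | t , p∈R′ = suc t , ∈-extend p p∈R′

    Isolated-add : ∀ {S} → Isolated Y′ S → Isolated Y ((ℓ , k) ∷ map embed S)
    Isolated-add {S} (uS , suppS , isoS) = unique , supp , iso
      where
      ℓk∉ : ∀ {q} → q ∈ map embed S → (ℓ , k) ≢ q
      ℓk∉ q∈ ℓk≡q with ∈-map⁻ embed q∈
      ... | (i , j) , _ , refl = punchInᵢ≢i ℓ i (sym (cong proj₁ ℓk≡q))
      unique : Unique ((ℓ , k) ∷ map embed S)
      unique = All.tabulate ℓk∉ ∷ map⁺ embed-injective uS
      supp : ∀ p → p ∈ (ℓ , k) ∷ map embed S → InSupp Y p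
      supp _ (here refl) = ℓk∈supp
      supp _ (there q∈) with ∈-map⁻ embed q∈
      ... | (i , j) , p∈ , refl = proj₂ (removeAt-𝟙⁻ i j (suppS _ p∈))
      iso : ∀ p q → p ∈ (ℓ , k) ∷ map embed S → q ∈ (ℓ , k) ∷ map embed S → p ≢ q →
            ¬ (Σ _ λ R → IsRect Y R × p ∈S R × q ∈S R)
      iso _ _ (here refl) (here refl) p≢q _ = p≢q refl
      iso _ _ (here refl) (there q∈) _ (R , R-rect , ℓk∈R , q∈R) with ∈-map⁻ embed q∈
      ... | q′ , q′∈ , refl = rect∋ℓk⇒¬supp R-rect ℓk∈R q′ q∈R (suppS q′ q′∈)
      iso _ _ (there p∈) (here refl) _ (R , R-rect , p∈R , ℓk∈R) with ∈-map⁻ embed p∈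
      ... | p′ , p′∈ , refl = rect∋ℓk⇒¬supp R-rect ℓk∈R p′ p∈R (suppS p′ p′∈)
      iso _ _ (there p∈) (there q∈) p≢q (R , R-rect , p∈R , q∈R)
        with ∈-map⁻ embed p∈ | ∈-map⁻ embed q∈
      ... | p′ , p′∈ , refl | q′ , q′∈ , refl =
        isoS p′ q′ p′∈ q′∈ (λ p′≡q′ → p≢q (cong embed p′≡q′)) (restrict R , IsRect-restrict R-rect , p∈R , q∈R)

    Isolated-remove : ∀ {S} → Isolated Y S → ∃ λ S′ → Isolated Y′ S′ × length S ≤ suc (length S′)
    Isolated-remove {S} (uS , suppS , isoS) = S′ , (unique , supp , iso) , length≤
      where
      outside? : Decidable (λ p → inBlock p ≡ false)
      outside? p = inBlock p ≟ᵇ false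
      F : List (Pos (suc m) (suc n))
      F = filter outside? S
      F⊆S : ∀ {p} → p ∈ F → p ∈ S × inBlock p ≡ false
      F⊆S = ∈-filter⁻ outside?
      F⊆embed : All (λ p′ → ∃ λ p → embed p ≡ p′) F
      F⊆embed = All.tabulate λ p′∈ → let (p∈S , outside) = F⊆S p′∈
                                         (p , embed-p , _) = supp∖block⊆embed _ (suppS _ p∈S) outside
                                     in p , embed-p
      S′ : List (Pos m n)
      S′ = preimage embed F F⊆embed
      embed∈F : ∀ {p} → p ∈ S′ → embed p ∈ F
      embed∈F = ∈-preimage⁻ embed
      unique : Unique S′
      unique = preimage⁺ embed F⊆embed (filter⁺ outside? uS)
      supp : ∀ p → p ∈ S′ → InSupp Y′ p
      supp (i , j) p∈ = let (p∈S , outside) = F⊆S (embed∈F p∈) in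
        removeAt-𝟙⁺ i j outside (suppS _ p∈S)
      iso : ∀ p q → p ∈ S′ → q ∈ S′ → p ≢ q → ¬ (Σ _ λ R → IsRect Y′ R × p ∈S R × q ∈S R)
      iso p q p∈ q∈ p≢q (R , R-rect , p∈R , q∈R) =
        isoS _ _ (proj₁ (F⊆S (embed∈F p∈))) (proj₁ (F⊆S (embed∈F q∈))) (λ e → p≢q (embed-injective e))
             (extend R , IsRect-extend block-rect R-rect , ∈-extend p p∈R , ∈-extend q q∈R)
      -- Two distinct entries of S inside I × J would share the rectangle I × J.
      inside-unique : ∀ {p q} → p ∈ S → q ∈ S → inBlock p ≢ false → inBlock q ≢ false → ¬ p ≢ q
      inside-unique p∈ q∈ p-in q-in p≢q =
        isoS _ _ p∈ q∈ p≢q (block , block-rect , ∧-true⁻ (¬-not p-in) , ∧-true⁻ (¬-not q-in))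
      length≤ : length S ≤ suc (length S′)
      length≤ = ≤-trans (length≤1+length-filter outside? uS inside-unique)
                        (s≤s (≤-reflexive (sym (length-preimage embed F F⊆embed))))

    i-removeAt : ∀ a → IsI Y (suc a) ⇔ IsI Y′ a
    i-removeAt a = mk⇔ to from
      where
      to : IsI Y (suc a) → IsI Y′ a
      to ((S , S-iso , |S|≡) , S-max) with Isolated-remove S-iso
      ... | S′ , S′-iso , |S|≤ =
        (take a S′ , Isolated-take a S′-iso , trans (length-take a S′) (m≤n⇒m⊓n≡m a≤|S′|)) ,
        λ T T-iso → s≤s⁻¹ (subst (_≤ suc a) (cong suc (length-map embed T)) (S-max _ (Isolated-add T-iso)))
        where
        a≤|S′| : a ≤ length S′
        a≤|S′| = s≤s⁻¹ (subst (_≤ suc (length S′)) |S|≡ |S|≤)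
      from : IsI Y′ a → IsI Y (suc a)
      from ((S′ , S′-iso , |S′|≡) , S′-max) =
        (_ , Isolated-add S′-iso , cong suc (trans (length-map embed S′) |S′|≡)) ,
        λ S S-iso → let (T , T-iso , |S|≤) = Isolated-remove S-iso in ≤-trans |S|≤ (s≤s (S′-max T T-iso))

    br-removeAt : ∀ b → IsBr Y (suc b) ⇔ IsBr Y′ b
    br-removeAt b = mk⇔
      (λ (cover , minimal) → Cover-remove cover , λ j cj → s≤s⁻¹ (minimal (suc j) (Cover-add cj)))
      (λ (cover′ , minimal′) → Cover-add cover′ , lift-minimal minimal′)
      where
      lift-minimal : (∀ j → Cover Y′ j → b ≤ j) → ∀ j → Cover Y j → suc b ≤ j
      lift-minimal _        zero    (_ , _ , R-cov) with R-cov (ℓ , k) ℓk∈supp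
      ... | () , _
      lift-minimal minimal′ (suc j) cj = s≤s (minimal′ j (Cover-remove cj))

lemma1 : ∀ {m n} (Y : Mat (suc m) (suc n)) (ℓ : Fin (suc m)) (k : Fin (suc n)) →
    Simplicial Y ℓ k →
    (∀ a → IsI Y (suc a) ⇔ IsI (removeAt Y ℓ k) a) ×
    (∀ b → IsBr Y (suc b) ⇔ IsBr (removeAt Y ℓ k) b)
lemma1 Y ℓ k simplicial = Removal.i-removeAt Y ℓ k simplicial , Removal.br-removeAt Y ℓ k simplicial
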